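{- Let $G$ be a $(P_5,\textit{HVN})$-free graph containing no induced $T$-5-wheel and no induced $Y$-5-wheel, and let $C=v_1v_2v_3v_4v_5v_1$ be an induced 5-cycle of $G$ (indices modulo 5). For $i\in\{1,\dots,5\}$ let $R_i$ be the set of vertices $u$ of $G$ whose set of neighbours in $V(C)$ is exactly $\{v_{i-1},v_{i+1}\}$. If $R_{i-1}\neq\emptyset$ and $R_{i+1}\neq\emptyset$, then $R_{i-1}$ is anticomplete to $R_{i+1}$.
   Context: Graphs are finite, simple and connected. $P_5$ is the path on 5 vertices; an HVN is a $K_4$ plus a vertex adjacent to exactly two vertices of the $K_4$; $(H_1,H_2)$-free means no induced $H_1$ or $H_2$. A $T$-5-wheel is a chordless 5-cycle $w_1w_2w_3w_4w_5w_1$ plus a vertex adjacent to exactly three consecutive vertices of it (e.g. $w_5,w_1,w_2$). A $Y$-5-wheel is a chordless 5-cycle $w_1w_2w_3w_4w_5w_1$ plus a vertex adjacent to exactly $w_1,w_2,w_4$. A set $A$ is anticomplete to $B$ if no vertex of $A$ is adjacent to a vertex of $B$. -}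

module Defs where

open import Data.Nat using (ℕ; zero; suc)
open import Data.Fin using (Fin; zero; suc)
open import Data.Fin.Properties using ()
open import Data.Bool using (Bool; true; false)
open import Data.Product using (Σ; _×_; _,_; ∃)
open import Data.Sum using (_⊎_)
open import Data.List using (List; []; _∷_)
open import Relation.Nullary using (¬_)
open import Relation.Binary.PropositionalEquality using (_≡_; _≢_)
open import Function.Bundles using (_⇔_)
open import Function.Definitions using (Injective)

record Graph : Set₁ where
  field
    n     : ℕ
    Adj   : Fin n → Fin n → Set
    sym   : ∀ {x y} → Adj x y → Adj y x
    irrefl : ∀ {x} → ¬ Adj x x

open Graph public

data Walk (G : Graph) : Fin (n G) → Fin (n G) → Set where
  here  : ∀ {x} → Walk G x x
  step  : ∀ {x y z} → Adj G x y → Walk G y z → Walk G x z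

Connected : Graph → Set
Connected G = ∀ x y → Walk G x y

Pattern : ℕ → Set
Pattern k = Fin k → Fin k → Bool

IsInducedCopy : (G : Graph) {k : ℕ} → Pattern k → (Fin k → Fin (n G)) → Set
IsInducedCopy G {k} H f =
  Injective _≡_ _≡_ f × (∀ i j → Adj G (f i) (f j) ⇔ (H i j ≡ true))

HasInduced : (G : Graph) {k : ℕ} → Pattern k → Set
HasInduced G {k} H = Σ (Fin k → Fin (n G)) (IsInducedCopy G H)

Free : (G : Graph) {k : ℕ} → Pattern k → Set
Free G H = ¬ HasInduced G H

pattern 0F = zero
pattern 1F = suc zero
pattern 2F = suc (suc zero)
pattern 3F = suc (suc (suc zero))
pattern 4F = suc (suc (suc (suc zero)))
pattern 5F = suc (suc (suc (suc (suc zero))))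

next : Fin 5 → Fin 5
next 0F = 1F
next 1F = 2F
next 2F = 3F
next 3F = 4F
next 4F = 0F

prev : Fin 5 → Fin 5
prev 0F = 4F
prev 1F = 0F
prev 2F = 1F
prev 3F = 2F
prev 4F = 3F

P5 : Pattern 5
P5 0F 1F = true
P5 1F 0F = true
P5 1F 2F = true
P5 2F 1F = true
P5 2F 3F = true
P5 3F 2F = true
P5 3F 4F = true
P5 4F 3F = true
P5 _ _ = false

C5 : Pattern 5
C5 0F 1F = true
C5 1F 0F = true
C5 1F 2F = true
C5 2F 1F = true
C5 2F 3F = true
C5 3F 2F = true
C5 3F 4F = true
C5 4F 3F = true
C5 4F 0F = true
C5 0F 4F = true
C5 _ _ = false

-- HVN: K4 on {0,1,2,3} plus vertex 4 adjacent exactly to 0 and 1.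
HVN : Pattern 5
HVN 0F 1F = true
HVN 0F 2F = true
HVN 0F 3F = true
HVN 1F 0F = true
HVN 1F 2F = true
HVN 1F 3F = true
HVN 2F 0F = true
HVN 2F 1F = true
HVN 2F 3F = true
HVN 3F 0F = true
HVN 3F 1F = true
HVN 3F 2F = true
HVN 4F 0F = true
HVN 4F 1F = true
HVN 0F 4F = true
HVN 1F 4F = true
HVN _ _ = false

-- Wheels: 5-cycle on vertices 0..4 (w1..w5 = 0..4) plus hub vertex 5
-- adjacent to the given cycle vertices.
wheel : (Fin 5 → Bool) → Pattern 6
wheel h 5F 5F = false
wheel h 5F 0F = h 0F
wheel h 5F 1F = h 1F
wheel h 5F 2F = h 2F
wheel h 5F 3F = h 3F
wheel h 5F 4F = h 4F
wheel h 0F 5F = h 0F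
wheel h 1F 5F = h 1F
wheel h 2F 5F = h 2F
wheel h 3F 5F = h 3F
wheel h 4F 5F = h 4F
wheel h 0F 0F = C5 0F 0F
wheel h 0F 1F = C5 0F 1F
wheel h 0F 2F = C5 0F 2F
wheel h 0F 3F = C5 0F 3F
wheel h 0F 4F = C5 0F 4F
wheel h 1F 0F = C5 1F 0F
wheel h 1F 1F = C5 1F 1F
wheel h 1F 2F = C5 1F 2F
wheel h 1F 3F = C5 1F 3F
wheel h 1F 4F = C5 1F 4F
wheel h 2F 0F = C5 2F 0F
wheel h 2F 1F = C5 2F 1F
wheel h 2F 2F = C5 2F 2F
wheel h 2F 3F = C5 2F 3F
wheel h 2F 4F = C5 2F 4F
wheel h 3F 0F = C5 3F 0F
wheel h 3F 1F = C5 3F 1F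
wheel h 3F 2F = C5 3F 2F
wheel h 3F 3F = C5 3F 3F
wheel h 3F 4F = C5 3F 4F
wheel h 4F 0F = C5 4F 0F
wheel h 4F 1F = C5 4F 1F
wheel h 4F 2F = C5 4F 2F
wheel h 4F 3F = C5 4F 3F
wheel h 4F 4F = C5 4F 4F

-- T-5-wheel: hub adjacent to exactly w5, w1, w2 (= 4, 0, 1).
T5Wheel : Pattern 6
T5Wheel = wheel λ { 0F → true ; 1F → true ; 4F → true ; _ → false }

-- Y-5-wheel: hub adjacent to exactly w1, w2, w4 (= 0, 1, 3).
Y5Wheel : Pattern 6
Y5Wheel = wheel λ { 0F → true ; 1F → true ; 3F → true ; _ → false }

InducedC5 : (G : Graph) → (Fin 5 → Fin (n G)) → Set
InducedC5 G v = IsInducedCopy G C5 v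

InR : (G : Graph) → (Fin 5 → Fin (n G)) → Fin 5 → Fin (n G) → Set
InR G v i u =
  (∀ j → u ≢ v j) ×
  (∀ j → Adj G u (v j) ⇔ ((j ≡ prev i) ⊎ (j ≡ next i)))

-- A vertex of R_j sees exactly the two cycle neighbours of v_j, so it can stand in for v_j
-- on the cycle.  If x ∈ R_{i-1} were adjacent to y ∈ R_{i+1}, then replacing v_{i+1} by y
-- gives an induced 5-cycle v_i y v_{i+2} v_{i+3} v_{i+4} on which x sees exactly v_i, y
-- and v_{i+3} = v_{i-2}: an induced Y-5-wheel.
module Submission where

open import Defs
open import Data.Bool using (Bool; true; false)
open import Data.Bool.Properties using () renaming (_≟_ to _≟ᵇ_)
open import Data.Empty using (⊥-elim)
open import Data.Fin using (Fin; inject₁; fromℕ; _≟_)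
open import Data.Fin.Properties using (all?)
open import Data.Fin.Relation.Unary.Top using (view; ‵fromℕ; ‵inject₁)
open import Data.Nat using (ℕ)
open import Data.Product using (∃; _,_; uncurry)
open import Data.Sum using (_⊎_; inj₁; inj₂)
open import Data.Vec.Functional using (updateAt)
open import Data.Vec.Functional.Properties using (updateAt-updates; updateAt-minimal)
open import Function.Base using (_∘_; const)
open import Function.Bundles using (_⇔_; mk⇔; Equivalence)
open import Function.Definitions using (Injective)
import Function.Properties.Equivalence as ⇔
open import Relation.Nullary using (¬_; Dec; yes; no)
open import Relation.Nullary.Decidable using (map′; from-yes; _×-dec_; _⊎-dec_; _→-dec_)
open import Relation.Binary.PropositionalEquality using (_≡_; refl; subst) renaming (sym to ≡-sym)

open Equivalence using (to; from)

private
  variable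
    k : ℕ
    A B : Set

_⇔?_ : Dec A → Dec B → Dec (A ⇔ B)
a? ⇔? b? = map′ (uncurry mk⇔) (λ e → to e , from e) ((a? →-dec b?) ×-dec (b? →-dec a?))

≡true-⇔⇒≡ : ∀ {a b} → (a ≡ true ⇔ b ≡ true) → a ≡ b
≡true-⇔⇒≡ {false} {false} _ = refl
≡true-⇔⇒≡ {false} {true}  e = from e refl
≡true-⇔⇒≡ {true}  {false} e = ≡-sym (to e refl)
≡true-⇔⇒≡ {true}  {true}  _ = refl

CycleAdjacent : Fin 5 → Fin 5 → Set
CycleAdjacent i j = j ≡ prev i ⊎ j ≡ next i

prev∘next≡next∘prev : ∀ i → prev (next i) ≡ next (prev i)
prev∘next≡next∘prev = from-yes (all? λ i → prev (next i) ≟ next (prev i))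

CycleAdjacent-next : ∀ i j → CycleAdjacent (next i) (next j) ⇔ CycleAdjacent i j
CycleAdjacent-next = from-yes (all? λ i → all? λ j →
  (next j ≟ prev (next i) ⊎-dec next j ≟ next (next i)) ⇔? (j ≟ prev i ⊎-dec j ≟ next i))

next-induction : (P : Fin 5 → Set) → P 0F → (∀ i → P i → P (next i)) → ∀ i → P i
next-induction P p₀ p-next 0F = p₀
next-induction P p₀ p-next 1F = p-next 0F p₀
next-induction P p₀ p-next 2F = p-next 1F (p-next 0F p₀)
next-induction P p₀ p-next 3F = p-next 2F (p-next 1F (p-next 0F p₀))
next-induction P p₀ p-next 4F = p-next 3F (p-next 2F (p-next 1F (p-next 0F p₀)))

C5-adjacent : ∀ i j → C5 i j ≡ true ⇔ CycleAdjacent i j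
C5-adjacent = from-yes (all? λ i → all? λ j →
  (C5 i j ≟ᵇ true) ⇔? (j ≟ prev i ⊎-dec j ≟ next i))

C5-irreflexive : ∀ i → C5 i i ≡ false
C5-irreflexive = from-yes (all? λ i → C5 i i ≟ᵇ false)

C5-symmetric : ∀ i j → C5 i j ≡ C5 j i
C5-symmetric = from-yes (all? λ i → all? λ j → C5 i j ≟ᵇ C5 j i)

C5-next : ∀ i j → C5 (next i) (next j) ≡ C5 i j
C5-next = from-yes (all? λ i → all? λ j → C5 (next i) (next j) ≟ᵇ C5 i j)

TwinFree : Pattern k → Set
TwinFree {k} H = ∀ (p q : Fin k) → (∀ r → H p r ≡ H q r) → p ≡ q

twinFree? : (H : Pattern k) → Dec (TwinFree H)
twinFree? H = all? λ p → all? λ q → all? (λ r → H p r ≟ᵇ H q r) →-dec p ≟ q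

Y5Wheel-twinFree : TwinFree Y5Wheel
Y5Wheel-twinFree = from-yes (twinFree? Y5Wheel)

withHub : (Fin 5 → A) → A → Fin 6 → A
withHub w h 0F = w 0F
withHub w h 1F = w 1F
withHub w h 2F = w 2F
withHub w h 3F = w 3F
withHub w h 4F = w 4F
withHub w h 5F = h

withHub-rim : (w : Fin 5 → A) (h : A) → ∀ j → withHub w h (inject₁ j) ≡ w j
withHub-rim w h 0F = refl
withHub-rim w h 1F = refl
withHub-rim w h 2F = refl
withHub-rim w h 3F = refl
withHub-rim w h 4F = refl

wheel-rim : ∀ S i j → wheel S (inject₁ i) (inject₁ j) ≡ C5 i j
wheel-rim S = from-yes (all? λ i → all? λ j → wheel S (inject₁ i) (inject₁ j) ≟ᵇ C5 i j)

wheel-hubˡ : ∀ S j → wheel S (fromℕ 5) (inject₁ j) ≡ S j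
wheel-hubˡ S 0F = refl
wheel-hubˡ S 1F = refl
wheel-hubˡ S 2F = refl
wheel-hubˡ S 3F = refl
wheel-hubˡ S 4F = refl

wheel-hubʳ : ∀ S j → wheel S (inject₁ j) (fromℕ 5) ≡ S j
wheel-hubʳ S 0F = refl
wheel-hubʳ S 1F = refl
wheel-hubʳ S 2F = refl
wheel-hubʳ S 3F = refl
wheel-hubʳ S 4F = refl

StrongHom : (G : Graph) → Pattern k → (Fin k → Fin (n G)) → Set
StrongHom {k} G H f = ∀ (p q : Fin k) → Adj G (f p) (f q) ⇔ (H p q ≡ true)

Anticomplete : (G : Graph) → (Fin 5 → Fin (n G)) → Fin 5 → Set
Anticomplete G v i = ∀ x y → InR G v (prev i) x → InR G v (next i) y → ¬ Adj G x y

module _ {G : Graph} where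

  private
    V : Set
    V = Fin (n G)

  Adj-⇔-sym : ∀ {x y} → Adj G x y ⇔ Adj G y x
  Adj-⇔-sym = mk⇔ (sym G) (sym G)

  strongHom-injective : {H : Pattern k} {f : Fin k → V} →
    TwinFree H → StrongHom G H f → Injective _≡_ _≡_ f
  strongHom-injective {H = H} {f} twinFree hom {p} {q} fp≡fq = twinFree p q same-row
    where
    same-row : ∀ r → H p r ≡ H q r
    same-row r = ≡true-⇔⇒≡
      (⇔.trans (subst (λ z → H p r ≡ true ⇔ Adj G z (f r)) fp≡fq (⇔.sym (hom p r))) (hom q r))

  strongHom⇒induced : {H : Pattern k} {f : Fin k → V} →
    TwinFree H → StrongHom G H f → IsInducedCopy G H f
  strongHom⇒induced twinFree hom = strongHom-injective twinFree hom , hom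

  wheel-strongHom : {w : Fin 5 → V} {h : V} {S : Fin 5 → Bool} →
    StrongHom G C5 w → (∀ j → Adj G h (w j) ⇔ (S j ≡ true)) →
    StrongHom G (wheel S) (withHub w h)
  wheel-strongHom {w} {h} {S} cycle hub p q with view p | view q
  ... | ‵inject₁ i | ‵inject₁ j
    rewrite withHub-rim w h i | withHub-rim w h j | wheel-rim S i j = cycle i j
  ... | ‵inject₁ i | ‵fromℕ
    rewrite withHub-rim w h i | wheel-hubʳ S i = ⇔.trans Adj-⇔-sym (hub i)
  ... | ‵fromℕ | ‵inject₁ j
    rewrite withHub-rim w h j | wheel-hubˡ S j = hub j
  ... | ‵fromℕ | ‵fromℕ = mk⇔ (⊥-elim ∘ irrefl G) λ ()

  replace-strongHom : {v : Fin 5 → V} {j : Fin 5} {u : V} →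
    StrongHom G C5 v → (∀ i → Adj G u (v i) ⇔ CycleAdjacent j i) →
    StrongHom G C5 (updateAt v j (const u))
  replace-strongHom {v} {j} {u} cycle u-adj p q with p ≟ j | q ≟ j
  ... | yes refl | yes refl
    rewrite updateAt-updates p {const u} v | C5-irreflexive p = mk⇔ (⊥-elim ∘ irrefl G) λ ()
  ... | yes refl | no q≢p
    rewrite updateAt-updates p {const u} v | updateAt-minimal q p {const u} v q≢p =
    ⇔.trans (u-adj q) (⇔.sym (C5-adjacent p q))
  ... | no p≢q | yes refl
    rewrite updateAt-updates q {const u} v | updateAt-minimal p q {const u} v p≢q | C5-symmetric p q =
    ⇔.trans Adj-⇔-sym (⇔.trans (u-adj p) (⇔.sym (C5-adjacent q p)))
  ... | no p≢j | no q≢j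
    rewrite updateAt-minimal p j {const u} v p≢j | updateAt-minimal q j {const u} v q≢j = cycle p q

  rotate-strongHom : {v : Fin 5 → V} → StrongHom G C5 v → StrongHom G C5 (v ∘ next)
  rotate-strongHom {v} cycle p q =
    subst (λ b → Adj G (v (next p)) (v (next q)) ⇔ (b ≡ true)) (C5-next p q) (cycle (next p) (next q))

  InR-rotate : {v : Fin 5 → V} {u : V} → ∀ i → InR G v (next i) u → InR G (v ∘ next) i u
  InR-rotate i (u∉C , u-adj) = u∉C ∘ next , λ j → ⇔.trans (u-adj (next j)) (CycleAdjacent-next i j)

  anticomplete-rotate : {v : Fin 5 → V} → ∀ i → Anticomplete G (v ∘ next) i → Anticomplete G v (next i)
  anticomplete-rotate {v} i anticomplete x y x∈R y∈R =
    anticomplete x y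
      (InR-rotate (prev i) (subst (λ j → InR G v j x) (prev∘next≡next∘prev i) x∈R))
      (InR-rotate (next i) y∈R)

  -- x ∈ R₄ and y ∈ R₁: on the cycle v₀ y v₂ v₃ v₄ the vertex x sees exactly v₀, y and v₃.
  Y5Wheel-free⇒anticomplete₀ : {v : Fin 5 → V} →
    Free G Y5Wheel → StrongHom G C5 v → Anticomplete G v 0F
  Y5Wheel-free⇒anticomplete₀ {v} noY cycle x y (_ , x-adj) (_ , y-adj) x~y =
    noY (withHub w x , strongHom⇒induced Y5Wheel-twinFree (wheel-strongHom w-cycle λ where
      0F → mk⇔ (const refl) (const (from (x-adj 0F) (inj₂ refl)))
      1F → mk⇔ (const refl) (const x~y)
      2F → mk⇔ (⊥-elim ∘ nonadjacent 2F λ { (inj₁ ()) ; (inj₂ ()) }) λ ()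
      3F → mk⇔ (const refl) (const (from (x-adj 3F) (inj₁ refl)))
      4F → mk⇔ (⊥-elim ∘ nonadjacent 4F λ { (inj₁ ()) ; (inj₂ ()) }) λ ()))
    where
    w : Fin 5 → V
    w = updateAt v 1F (const y)
    w-cycle : StrongHom G C5 w
    w-cycle = replace-strongHom cycle y-adj
    nonadjacent : ∀ j → ¬ CycleAdjacent 4F j → ¬ Adj G x (v j)
    nonadjacent j j∉N = j∉N ∘ to (x-adj j)

  Y5Wheel-free⇒anticomplete : Free G Y5Wheel → ∀ i {v : Fin 5 → V} → StrongHom G C5 v → Anticomplete G v i
  Y5Wheel-free⇒anticomplete noY =
    next-induction (λ i → ∀ {v} → StrongHom G C5 v → Anticomplete G v i)
      (Y5Wheel-free⇒anticomplete₀ noY)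
      (λ i anticomplete cycle → anticomplete-rotate i (anticomplete (rotate-strongHom cycle)))

lemma5p3 : (G : Graph) → Connected G →
    Free G P5 → Free G HVN → Free G T5Wheel → Free G Y5Wheel →
    (v : Fin 5 → Fin (n G)) → InducedC5 G v →
    (i : Fin 5) →
    ∃ (InR G v (prev i)) → ∃ (InR G v (next i)) →
    ∀ x y → InR G v (prev i) x → InR G v (next i) y → ¬ Adj G x y
lemma5p3 G _ _ _ _ noY v (_ , cycle) i _ _ = Y5Wheel-free⇒anticomplete {G = G} noY i cycle
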